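{- Let $\alpha$ be a formal parameter or a complex number that is neither $0$ nor a negative rational, let $0\le m\le N$, let $\gamma$ be a composition with $N$ parts, and let $\Gamma=\varphi_m(\gamma)$. Then $E_\gamma(x;\alpha)$ is an eigenfunction of $S^*(u)$ and of $S^\circledast(u,v)$, and $S^*(u)E_\gamma=\varepsilon_{\Gamma^*}(\alpha,u)E_\gamma$, $S^\circledast(u,u)E_\gamma=\varepsilon_{\Gamma^\circledast}(\alpha,u)E_\gamma$.
   Context: $x=(x_1,\dots,x_N)$; $K_{i,j}$ exchanges $x_i,x_j$. Compositions $\gamma\in\mathbb{Z}_{\ge0}^N$, $\gamma^+$ decreasing rearrangement; $\eta\succ\nu$ iff $\eta\ne\nu$, same degree, and $\eta^+>\nu^+$ in dominance order, or $\eta^+=\nu^+$ and $\sum_{i\le k}\eta_i\ge\sum_{i\le k}\nu_i$ for all $k$. Cherednik operators $\xi_j=\alpha x_j\partial_{x_j}+\sum_{i<j}\frac{x_j}{x_j-x_i}(1-K_{i,j})+\sum_{i>j}\frac{x_i}{x_j-x_i}(1-K_{i,j})-(j-1)$. $E_\gamma(x;\alpha)$ is the unique polynomial $x^\gamma+\sum_{\nu\prec\gamma}c_{\gamma,\nu}x^\nu$ with $\xi_jE_\gamma=\bar\gamma_jE_\gamma$ for all $j$, $\bar\gamma_j=\alpha\gamma_j-\#\{i<j:\gamma_i\ge\gamma_j\}-\#\{i>j:\gamma_i>\gamma_j\}$. $\varphi_m(\gamma)$ is the superpartition $\Gamma$ with $\Gamma^*=(\gamma_1,\dots,\gamma_N)^+$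 and $\Gamma^\circledast=(\gamma_1+1,\dots,\gamma_m+1,\gamma_{m+1},\dots,\gamma_N)^+$. Sekiguchi operators $S^*(u)=\prod_{i=1}^N(u+\xi_i)$, $S^\circledast(u,v)=\prod_{i=1}^m(u+\xi_i+\alpha)\prod_{i=m+1}^N(v+\xi_i)$ with $u,v$ formal; for a partition $\lambda$ padded to $N$ parts, $\varepsilon_\lambda(\alpha,u)=\prod_{i=1}^N(u+\alpha\lambda_i-i+1)$. -}

module Defs where

open import Level using (Level; _⊔_)
open import Algebra.Bundles using (CommutativeRing)
open import Data.Nat as ℕ using (ℕ; zero; suc; _<ᵇ_; _≤ᵇ_; _∸_)
open import Data.Bool using (Bool; true; false; if_then_else_; _∧_)
open import Data.Fin using (Fin; toℕ)
open import Data.Vec as Vec using (Vec; []; _∷_; lookup; tabulate; _[_]≔_; _[_]%=_)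
open import Data.Vec.Properties using (≡-dec)
open import Data.Nat.ListAction using () renaming (sum to sumℕ)
open import Data.List as List using (List; []; _∷_; _++_; map; concatMap; filterᵇ; upTo; allFin; foldr; take; length)
open import Data.Product using (∃; _×_; _,_; proj₁; proj₂)
open import Data.Sum using (_⊎_)
open import Relation.Nullary using (¬_; does)
open import Relation.Binary.PropositionalEquality using (_≡_; _≢_)

-- Compositions with N parts are vectors  Vec ℕ N  (index i : Fin N is the
-- (toℕ i + 1)-th part).

deg : ∀ {N} → Vec ℕ N → ℕ
deg v = sumℕ (Vec.toList v)

insertDec : ∀ {n} → ℕ → Vec ℕ n → Vec ℕ (suc n)
insertDec x []       = x ∷ []
insertDec x (y ∷ ys) = if y ≤ᵇ x then x ∷ y ∷ ys else y ∷ insertDec x ys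

sortDec : ∀ {n} → Vec ℕ n → Vec ℕ n
sortDec []       = []
sortDec (x ∷ xs) = insertDec x (sortDec xs)

psum : ∀ {N} → ℕ → Vec ℕ N → ℕ
psum k v = sumℕ (take k (Vec.toList v))

Dominates : ∀ {N} → Vec ℕ N → Vec ℕ N → Set
Dominates η ν = ∀ k → psum k ν ℕ.≤ psum k η

_≻_ : ∀ {N} → Vec ℕ N → Vec ℕ N → Set
η ≻ ν = (η ≢ ν) × (deg η ≡ deg ν) ×
        ( ((sortDec η ≢ sortDec ν) × Dominates (sortDec η) (sortDec ν))
        ⊎ ((sortDec η ≡ sortDec ν) × Dominates η ν) )

module _ {c ℓ : Level} (R : CommutativeRing c ℓ) where
  open CommutativeRing R

  natR : ℕ → Carrier
  natR zero    = 0#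
  natR (suc n) = 1# + natR n

  record IsCharZeroField : Set (c ⊔ ℓ) where
    field
      nontrivial : ¬ (1# ≈ 0#)
      inverse    : ∀ x → ¬ (x ≈ 0#) → ∃ λ y → (x * y) ≈ 1#
      charZero   : ∀ n → ¬ (natR (suc n) ≈ 0#)

  -- α is neither 0 nor a negative rational:  α ≠ 0 and α ≠ -(p+1)/(q+1)
  record AdmissibleParam (α : Carrier) : Set ℓ where
    field
      nonzero     : ¬ (α ≈ 0#)
      notNegRat   : ∀ p q → ¬ ((natR (suc q) * α + natR (suc p)) ≈ 0#)

  -- Polynomials in x₁,…,x_N with coefficients in R, as formal finite sums
  -- of terms  c · x^a ; two polynomials are equal iff all coefficients agree.

  Poly : ℕ → Set c
  Poly N = List (Carrier × Vec ℕ N)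

  coeff : ∀ {N} → Poly N → Vec ℕ N → Carrier
  coeff []             b = 0#
  coeff ((d , a) ∷ ps) b =
    (if does (≡-dec ℕ._≟_ a b) then d else 0#) + coeff ps b

  _≈P_ : ∀ {N} → Poly N → Poly N → Set ℓ
  p ≈P q = ∀ b → coeff p b ≈ coeff q b

  mono : ∀ {N} → Vec ℕ N → Poly N
  mono a = (1# , a) ∷ []

  scale : ∀ {N} → Carrier → Poly N → Poly N
  scale k = map (λ t → (k * proj₁ t , proj₂ t))

  addP : ∀ {N} → Poly N → Poly N → Poly N
  addP = _++_

  mulX : ∀ {N} → Fin N → Poly N → Poly N
  mulX k = map (λ t → (proj₁ t , proj₂ t [ k ]%= suc))

  -- x_j ∂/∂x_j
  euler : ∀ {N} → Fin N → Poly N → Poly N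
  euler j = map (λ t → (natR (lookup (proj₂ t) j) * proj₁ t , proj₂ t))

  -- (x^a - K_{i,j} x^a) / (x_j - x_i)   for i ≠ j  (exact polynomial quotient)
  ddMono : ∀ {N} → Fin N → Fin N → Vec ℕ N → Poly N
  ddMono i j a with lookup a i | lookup a j
  ... | p | q =
    if p <ᵇ q then
      map (λ k → (1# , (a [ i ]≔ (p ℕ.+ k)) [ j ]≔ (q ∸ 1 ∸ k))) (upTo (q ∸ p))
    else if q <ᵇ p then
      map (λ k → (- 1# , (a [ i ]≔ (q ℕ.+ k)) [ j ]≔ (p ∸ 1 ∸ k))) (upTo (p ∸ q))
    else []

  dd : ∀ {N} → Fin N → Fin N → Poly N → Poly N
  dd i j = concatMap (λ t → scale (proj₁ t) (ddMono i j (proj₂ t)))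

  -- Cherednik operator ξ_j  (j is the (toℕ j + 1)-th index, so "j - 1" = toℕ j)
  xi : ∀ {N} → Carrier → Fin N → Poly N → Poly N
  xi {N} α j f =
    scale α (euler j f)
    ++ concatMap (λ i → mulX j (dd i j f)) (filterᵇ (λ i → toℕ i <ᵇ toℕ j) (allFin N))
    ++ concatMap (λ i → mulX i (dd i j f)) (filterᵇ (λ i → toℕ j <ᵇ toℕ i) (allFin N))
    ++ scale (- natR (toℕ j)) f

  -- Sekiguchi operators  S*(u) = ∏ (u + ξ_i),
  -- S⊛(u,v) = ∏_{i ≤ m} (u + ξ_i + α) ∏_{i > m} (v + ξ_i)
  Sstar : ∀ {N} → Carrier → Carrier → Poly N → Poly N
  Sstar {N} α u f = foldr (λ i g → scale u g ++ xi α i g) f (allFin N)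

  Scirc : ∀ {N} → Carrier → ℕ → Carrier → Carrier → Poly N → Poly N
  Scirc {N} α m u v f =
    foldr (λ i g → if toℕ i <ᵇ m then scale (u + α) g ++ xi α i g
                                 else scale v g ++ xi α i g) f (allFin N)

  gammaBar : ∀ {N} → Carrier → Vec ℕ N → Fin N → Carrier
  gammaBar {N} α γ j =
    α * natR (lookup γ j)
    - natR (length (filterᵇ (λ i → (toℕ i <ᵇ toℕ j) ∧ (lookup γ j ≤ᵇ lookup γ i)) (allFin N))
            ℕ.+ length (filterᵇ (λ i → (toℕ j <ᵇ toℕ i) ∧ (lookup γ j <ᵇ lookup γ i)) (allFin N)))

  -- E is the non-symmetric Jack polynomial E_γ(x;α):
  -- monic x^γ + lower terms (w.r.t. ≺), and ξ_j E = γ̄_j E for all j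
  record IsNSJack {N} (α : Carrier) (γ : Vec ℕ N) (E : Poly N) : Set ℓ where
    field
      leading    : coeff E γ ≈ 1#
      triangular : ∀ ν → ν ≢ γ → ¬ (γ ≻ ν) → coeff E ν ≈ 0#
      eigen      : ∀ j → xi α j E ≈P scale (gammaBar α γ j) E

  -- ε_λ(α,u) = ∏_{i=1}^N (u + α λ_i - i + 1)
  epsilon : ∀ {N} → Carrier → Vec ℕ N → Carrier → Carrier
  epsilon {N} α lam u =
    foldr (λ i r → (u + α * natR (lookup lam i) - natR (toℕ i)) * r) 1# (allFin N)

GammaStar : ∀ {N} → Vec ℕ N → Vec ℕ N
GammaStar γ = sortDec γ

GammaCirc : ∀ {N} → ℕ → Vec ℕ N → Vec ℕ N
GammaCirc m γ = sortDec (tabulate (λ i → if toℕ i <ᵇ m then suc (lookup γ i) else lookup γ i))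

-- Each Cherednik operator ξ_j acts termwise: pairing ξ_j p with a weight w : ℕ^N → R equals
-- pairing p with a weight that depends on w alone. As coefficientwise equal polynomials have equal
-- pairings, the eigen-equations ξ_j E = γ̄_j E can be pushed through ∏_i (s_i + ξ_i) one factor at
-- a time, so this product acts on E as the scalar ∏_i (s_i + γ̄_i).
-- The eigenvalue γ̄_j is α γ_j − r(j), where r(j) is the position of γ_j in the stable decreasing
-- sort of γ. As r is a bijection onto positions, ∏_j (u + γ̄_j) = ∏_k (u + α γ⁺_k − k) = ε_{Γ*}.
-- In S⊛(u,u) the extra α in the first m factors replaces γ_j by γ_j + 1 there, and r still sorts
-- the bumped composition decreasingly, which gives ε_{Γ⊛}.

module Submission where

open import Defs
open import Algebra.Bundles using (CommutativeRing)
open import Data.Nat using (ℕ; _≤_)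
open import Data.Vec using (Vec)
open import Data.Product using (_×_; ∃)

open import Level using (_⊔_)
open import Data.Nat as ℕ using (zero; suc; _<_; _≤ᵇ_; _<ᵇ_; _≤?_; _<?_; z≤n; s≤s)
open import Data.Nat.Properties
  using (≤-refl; ≤-reflexive; ≤-trans; <-trans; <⇒≤; <⇒≱; ≤⇒≯; ≤-<-trans; <-≤-trans; ≤-pred;
         n<1+n; m<n⇒m<1+n; m≤n⇒m≤1+n; m≤n⇒m<n∨m≡n; ≰⇒>; n≮0; +-mono-<-≤;
         <ᵇ⇒<; ≤ᵇ⇒≤; ≤⇒≤ᵇ; <⇒<ᵇ; ≤ᵇ-reflects-≤)
open import Data.Bool using (Bool; true; false; if_then_else_; _∧_; not; T)
open import Data.Fin using (Fin; toℕ) renaming (zero to fzero; suc to fsuc)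
open import Data.Vec as Vec using ([]; _∷_; lookup; countᵇ)
open import Data.Vec.Properties using (tabulate∘lookup; tabulate-cong; ≡-dec)
open import Data.Vec.Relation.Unary.All as All using (All; []; _∷_)
open import Data.Vec.Relation.Unary.AllPairs using (AllPairs; []; _∷_)
open import Data.List as List using (List; []; _∷_; length; filterᵇ; allFin)
open import Data.List.Properties using (length-filter; foldr-cong)
open import Data.Product using (_,_; proj₂)
open import Data.Sum using (inj₁; inj₂)
open import Data.Empty using (⊥-elim)
open import Function using (id; _∘_)
open import Relation.Nullary using (does; yes; no)
open import Relation.Nullary.Reflects using (ofʸ; ofⁿ)
open import Relation.Nullary.Decidable using (dec-true; dec-false)
open import Relation.Binary.PropositionalEquality as ≡ using (_≡_; _≢_; refl; cong; cong₂)

-- Ranks and sorting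

≤ᵇ-true : ∀ {m n} → m ≤ n → (m ≤ᵇ n) ≡ true
≤ᵇ-true {m} {n} = dec-true (m ≤? n)

≤ᵇ-false : ∀ {m n} → n < m → (m ≤ᵇ n) ≡ false
≤ᵇ-false {m} {n} n<m = dec-false (m ≤? n) (<⇒≱ n<m)

<ᵇ-true : ∀ {m n} → m < n → (m <ᵇ n) ≡ true
<ᵇ-true {m} {n} = dec-true (m <? n)

<ᵇ-false : ∀ {m n} → n ≤ m → (m <ᵇ n) ≡ false
<ᵇ-false {m} {n} n≤m = dec-false (m <? n) (≤⇒≯ n≤m)

<ᵇ⇒≤ᵇ : ∀ m n → T (m <ᵇ n) → T (m ≤ᵇ n)
<ᵇ⇒≤ᵇ m n = ≤⇒≤ᵇ ∘ <⇒≤ ∘ <ᵇ⇒< m n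

sucIf : Bool → ℕ → ℕ
sucIf b = if b then suc else id

sucIf-mono-≤ : ∀ {a b m n} → (T a → T b) → m ≤ n → sucIf a m ≤ sucIf b n
sucIf-mono-≤ {false} {false} _ m≤n = m≤n
sucIf-mono-≤ {false} {true}  _ m≤n = m≤n⇒m≤1+n m≤n
sucIf-mono-≤ {true}  {false} a⇒b _ = ⊥-elim (a⇒b _)
sucIf-mono-≤ {true}  {true}  _ m≤n = s≤s m≤n

sucIf-monoʳ-< : ∀ b {m n} → m < n → sucIf b m < sucIf b n
sucIf-monoʳ-< false m<n = m<n
sucIf-monoʳ-< true  m<n = s≤s m<n

sucIf-comm : ∀ a b n → sucIf a (sucIf b n) ≡ sucIf b (sucIf a n)
sucIf-comm false b     n = refl
sucIf-comm true  false n = refl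
sucIf-comm true  true  n = refl

sucIf-+ : ∀ b m n → sucIf b m ℕ.+ n ≡ sucIf b (m ℕ.+ n)
sucIf-+ false m n = refl
sucIf-+ true  m n = refl

punchInℕ : ℕ → ℕ → ℕ
punchInℕ t c = sucIf (t ≤ᵇ c) c

punchInℕ-suc : ∀ t c → punchInℕ (suc t) (suc c) ≡ suc (punchInℕ t c)
punchInℕ-suc zero    c = refl
punchInℕ-suc (suc t) c with t <ᵇ c
... | true  = refl
... | false = refl

countᵇ-mono : ∀ {n} {p q : ℕ → Bool} → (∀ w → T (p w) → T (q w)) → (v : Vec ℕ n) →
              countᵇ p v ≤ countᵇ q v
countᵇ-mono p⇒q []      = z≤n
countᵇ-mono p⇒q (x ∷ v) = sucIf-mono-≤ (p⇒q x) (countᵇ-mono p⇒q v)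

countᵇ-none : ∀ {n} {q : ℕ → Bool} {v : Vec ℕ n} → All (λ w → q w ≡ false) v → countᵇ q v ≡ 0
countᵇ-none []             = refl
countᵇ-none (qx≡false ∷ a) rewrite qx≡false = countᵇ-none a

countFin : ∀ {n} → (Fin n → Bool) → ℕ
countFin {zero}  p = 0
countFin {suc n} p = sucIf (p fzero) (countFin (p ∘ fsuc))

length-filterᵇ-tabulate : ∀ {A : Set} {n} (p : A → Bool) (h : Fin n → A) →
                          length (filterᵇ p (List.tabulate h)) ≡ countFin (p ∘ h)
length-filterᵇ-tabulate {n = zero}  p h = refl
length-filterᵇ-tabulate {n = suc n} p h with p (h fzero)
... | true  = cong suc (length-filterᵇ-tabulate p (h ∘ fsuc))
... | false = length-filterᵇ-tabulate p (h ∘ fsuc)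

countFin-lookup : ∀ {n} (q : ℕ → Bool) (v : Vec ℕ n) → countFin (q ∘ lookup v) ≡ countᵇ q v
countFin-lookup q []      = refl
countFin-lookup q (x ∷ v) = cong (sucIf (q x)) (countFin-lookup q v)

-- The number subtracted in γ̄_j: the position of γ_j in the stable decreasing sort of γ.
rank : ∀ {N} → Vec ℕ N → Fin N → ℕ
rank {N} γ j =
  length (filterᵇ (λ i → (toℕ i <ᵇ toℕ j) ∧ (lookup γ j ≤ᵇ lookup γ i)) (allFin N))
  ℕ.+ length (filterᵇ (λ i → (toℕ j <ᵇ toℕ i) ∧ (lookup γ j <ᵇ lookup γ i)) (allFin N))

rank-countFin : ∀ {N} (γ : Vec ℕ N) j → rank γ j ≡
  countFin (λ i → (toℕ i <ᵇ toℕ j) ∧ (lookup γ j ≤ᵇ lookup γ i))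
  ℕ.+ countFin (λ i → (toℕ j <ᵇ toℕ i) ∧ (lookup γ j <ᵇ lookup γ i))
rank-countFin γ j =
  cong₂ ℕ._+_ (length-filterᵇ-tabulate (λ i → (toℕ i <ᵇ toℕ j) ∧ (lookup γ j ≤ᵇ lookup γ i)) id)
            (length-filterᵇ-tabulate (λ i → (toℕ j <ᵇ toℕ i) ∧ (lookup γ j <ᵇ lookup γ i)) id)

rank-head : ∀ {n} x (γ : Vec ℕ n) → rank (x ∷ γ) fzero ≡ countᵇ (x <ᵇ_) γ
rank-head {n} x γ = ≡.trans (rank-countFin (x ∷ γ) fzero)
                            (cong₂ ℕ._+_ (countFin-false n) (countFin-lookup (x <ᵇ_) γ))
  where
  countFin-false : ∀ n → countFin {n} (λ _ → false) ≡ 0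
  countFin-false zero    = refl
  countFin-false (suc n) = countFin-false n

rank-tail : ∀ {n} x (γ : Vec ℕ n) k → rank (x ∷ γ) (fsuc k) ≡ sucIf (lookup γ k ≤ᵇ x) (rank γ k)
rank-tail x γ k =
  ≡.trans (rank-countFin (x ∷ γ) (fsuc k)) (≡.trans (sucIf-+ b _ _) (cong (sucIf b) (≡.sym (rank-countFin γ k))))
  where b = lookup γ k ≤ᵇ x

rank-lower : ∀ {n} (γ : Vec ℕ n) k → countᵇ (lookup γ k <ᵇ_) γ ≤ rank γ k
rank-lower (x ∷ γ) fzero rewrite rank-head x γ | <ᵇ-false (≤-refl {x}) = ≤-refl
rank-lower (x ∷ γ) (fsuc k) rewrite rank-tail x γ k =
  sucIf-mono-≤ (<ᵇ⇒≤ᵇ (lookup γ k) x) (rank-lower γ k)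

rank-upper : ∀ {n} (γ : Vec ℕ n) k → rank γ k < countᵇ (lookup γ k ≤ᵇ_) γ
rank-upper (x ∷ γ) fzero rewrite rank-head x γ | ≤ᵇ-true (≤-refl {x}) =
  s≤s (countᵇ-mono (<ᵇ⇒≤ᵇ x) γ)
rank-upper (x ∷ γ) (fsuc k) rewrite rank-tail x γ k =
  sucIf-monoʳ-< (lookup γ k ≤ᵇ x) (rank-upper γ k)

rank-tail-punchIn : ∀ {n} x (γ : Vec ℕ n) k →
                    rank (x ∷ γ) (fsuc k) ≡ punchInℕ (countᵇ (x <ᵇ_) γ) (rank γ k)
rank-tail-punchIn x γ k with lookup γ k ≤ᵇ x | ≤ᵇ-reflects-≤ (lookup γ k) x | rank-tail x γ k
... | true | ofʸ γk≤x | eq = ≡.trans eq (cong (λ b → sucIf b (rank γ k)) (≡.sym (≤ᵇ-true t≤rank)))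
  where
  t≤rank : countᵇ (x <ᵇ_) γ ≤ rank γ k
  t≤rank = ≤-trans (countᵇ-mono (λ w x<w → <⇒<ᵇ (≤-<-trans γk≤x (<ᵇ⇒< x w x<w))) γ) (rank-lower γ k)
... | false | ofⁿ γk≰x | eq = ≡.trans eq (cong (λ b → sucIf b (rank γ k)) (≡.sym (≤ᵇ-false rank<t)))
  where
  rank<t : rank γ k < countᵇ (x <ᵇ_) γ
  rank<t = <-≤-trans (rank-upper γ k)
             (countᵇ-mono (λ w γk≤w → <⇒<ᵇ (<-≤-trans (≰⇒> γk≰x) (≤ᵇ⇒≤ (lookup γ k) w γk≤w))) γ)

SortedDec : ∀ {n} → Vec ℕ n → Set
SortedDec = AllPairs (λ x y → y ≤ x)

insertDec-All≤ : ∀ {n x y} → x ≤ y → {v : Vec ℕ n} → All (_≤ y) v → All (_≤ y) (insertDec x v)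
insertDec-All≤ x≤y [] = x≤y ∷ []
insertDec-All≤ {x = x} x≤y {z ∷ v} (z≤y ∷ a) with z ≤ᵇ x
... | true  = x≤y ∷ z≤y ∷ a
... | false = z≤y ∷ insertDec-All≤ x≤y a

insertDec-sorted : ∀ {n} x {v : Vec ℕ n} → SortedDec v → SortedDec (insertDec x v)
insertDec-sorted x [] = [] ∷ []
insertDec-sorted x {z ∷ v} (a ∷ s) with z ≤ᵇ x | ≤ᵇ-reflects-≤ z x
... | true  | ofʸ z≤x = (z≤x ∷ All.map (λ w≤z → ≤-trans w≤z z≤x) a) ∷ a ∷ s
... | false | ofⁿ z≰x = insertDec-All≤ (<⇒≤ (≰⇒> z≰x)) a ∷ insertDec-sorted x s

sortDec-sorted : ∀ {n} (v : Vec ℕ n) → SortedDec (sortDec v)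
sortDec-sorted []      = []
sortDec-sorted (x ∷ v) = insertDec-sorted x (sortDec-sorted v)

insertDec-max : ∀ {n y} {v : Vec ℕ n} → All (_≤ y) v → insertDec y v ≡ y ∷ v
insertDec-max []          = refl
insertDec-max (z≤y ∷ _) rewrite ≤ᵇ-true z≤y = refl

countᵇ-insertDec : ∀ {n} (q : ℕ → Bool) x (v : Vec ℕ n) →
                   countᵇ q (insertDec x v) ≡ sucIf (q x) (countᵇ q v)
countᵇ-insertDec q x []      = refl
countᵇ-insertDec q x (z ∷ v) with z ≤ᵇ x
... | true  = refl
... | false = ≡.trans (cong (sucIf (q z)) (countᵇ-insertDec q x v)) (sucIf-comm (q z) (q x) _)

countᵇ-sortDec : ∀ {n} (q : ℕ → Bool) (v : Vec ℕ n) → countᵇ q (sortDec v) ≡ countᵇ q v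
countᵇ-sortDec q []      = refl
countᵇ-sortDec q (x ∷ v) =
  ≡.trans (countᵇ-insertDec q x (sortDec v)) (cong (sucIf (q x)) (countᵇ-sortDec q v))

bumpPrefix : ∀ {n} → ℕ → Vec ℕ n → Vec ℕ n
bumpPrefix zero    v       = v
bumpPrefix (suc m) []      = []
bumpPrefix (suc m) (x ∷ v) = suc x ∷ bumpPrefix m v

lookup-bumpPrefix : ∀ {n} m (γ : Vec ℕ n) i →
                    lookup (bumpPrefix m γ) i ≡ (if toℕ i <ᵇ m then suc (lookup γ i) else lookup γ i)
lookup-bumpPrefix zero    γ       i        = refl
lookup-bumpPrefix (suc m) (x ∷ γ) fzero    = refl
lookup-bumpPrefix (suc m) (x ∷ γ) (fsuc i) = lookup-bumpPrefix m γ i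

GammaCirc-bumpPrefix : ∀ {N} m (γ : Vec ℕ N) → GammaCirc m γ ≡ sortDec (bumpPrefix m γ)
GammaCirc-bumpPrefix m γ =
  cong sortDec (≡.trans (tabulate-cong (≡.sym ∘ lookup-bumpPrefix m γ)) (tabulate∘lookup (bumpPrefix m γ)))

countᵇ->-bumpPrefix : ∀ {n} x m (γ : Vec ℕ n) → countᵇ (suc x <ᵇ_) (bumpPrefix m γ) ≤ countᵇ (x <ᵇ_) γ
countᵇ->-bumpPrefix x zero    γ       =
  countᵇ-mono (λ w 1+x<w → <⇒<ᵇ (<-trans (n<1+n x) (<ᵇ⇒< (suc x) w 1+x<w))) γ
countᵇ->-bumpPrefix x (suc m) []      = z≤n
countᵇ->-bumpPrefix x (suc m) (w ∷ γ) = sucIf-mono-≤ {x <ᵇ w} id (countᵇ->-bumpPrefix x m γ)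

countᵇ-≥-bumpPrefix : ∀ {n} x m (γ : Vec ℕ n) → countᵇ (x <ᵇ_) γ ≤ countᵇ (suc x ≤ᵇ_) (bumpPrefix m γ)
countᵇ-≥-bumpPrefix x zero    γ       = ≤-refl
countᵇ-≥-bumpPrefix x (suc m) []      = z≤n
countᵇ-≥-bumpPrefix x (suc m) (w ∷ γ) =
  sucIf-mono-≤ (<⇒<ᵇ ∘ m<n⇒m<1+n ∘ <ᵇ⇒< x w) (countᵇ-≥-bumpPrefix x m γ)

-- Products over positions

module _ {c ℓ} (R : CommutativeRing c ℓ) where

  open CommutativeRing R hiding (zero) renaming (refl to ≈-refl)
  open import Algebra.Properties.Monoid.Sum *-monoid using () renaming (sum to ∏; sum-cong-≋ to ∏-cong)
  open import Relation.Binary.Reasoning.Setoid setoid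
  open import Algebra.Solver.Ring.NaturalCoefficients.Default commutativeSemiring

  ≡⇒≈ : ∀ {x y} → x ≡ y → x ≈ y
  ≡⇒≈ refl = ≈-refl

  foldr-tabulate-∏ : ∀ {N n} (f : Fin N → Carrier) (h : Fin n → Fin N) →
                     List.foldr (λ i r → f i * r) 1# (List.tabulate h) ≡ ∏ (f ∘ h)
  foldr-tabulate-∏ {n = zero}  f h = refl
  foldr-tabulate-∏ {n = suc n} f h = cong (f (h fzero) *_) (foldr-tabulate-∏ f (h ∘ fsuc))

  ∏pos : ∀ {n} → (ℕ → ℕ → Carrier) → Vec ℕ n → Carrier
  ∏pos F v = ∏ (λ i → F (lookup v i) (toℕ i))

  ∏pos-punchIn-suc : ∀ {n} (F : ℕ → ℕ → Carrier) a y t (zs : Vec ℕ n) →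
    F a 0 * (F y (suc t) * ∏pos (λ w c → F w (suc (punchInℕ t c))) zs)
      ≈ F y (suc t) * ∏pos (λ w c → F w (punchInℕ (suc t) c)) (a ∷ zs)
  ∏pos-punchIn-suc F a y t zs = begin
    F a 0 * (F y (suc t) * P)  ≈⟨ solve 3 (λ a b p → a :* (b :* p) := b :* (a :* p)) ≈-refl _ _ P ⟩
    F y (suc t) * (F a 0 * P)  ≈⟨ *-congˡ (*-congˡ P≈Q) ⟩
    F y (suc t) * (F a 0 * Q)  ∎
    where
    P = ∏pos (λ w c → F w (suc (punchInℕ t c))) zs
    Q = ∏pos (λ w c → F w (punchInℕ (suc t) (suc c))) zs
    P≈Q : P ≈ Q
    P≈Q = ∏-cong {x = λ i → F (lookup zs i) (suc (punchInℕ t (toℕ i)))}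
                 (λ i → ≡⇒≈ (cong (F (lookup zs i)) (≡.sym (punchInℕ-suc t (toℕ i)))))

  -- t may be any slot for y compatible with the order: ties with y may go on either side.
  ∏pos-insertDec : ∀ {n} {v : Vec ℕ n} → SortedDec v →
                   ∀ y t → countᵇ (y <ᵇ_) v ≤ t → t ≤ countᵇ (y ≤ᵇ_) v →
                   ∀ F → ∏pos F (insertDec y v) ≈ F y t * ∏pos (λ w c → F w (punchInℕ t c)) v
  ∏pos-insertDec [] y zero _ _ F = ≈-refl
  ∏pos-insertDec {v = z ∷ zs} (a ∷ s) y t lo hi F with z ≤ᵇ y | ≤ᵇ-reflects-≤ z y
  ... | true | ofʸ z≤y with t | m≤n⇒m<n∨m≡n z≤y
  ...   | zero  | _ = ≈-refl
  ...   | suc t | inj₁ z<y = ⊥-elim (n≮0 (≤-trans hi (≤-reflexive none≥y)))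
    where
    none≥y : countᵇ (y ≤ᵇ_) (z ∷ zs) ≡ 0
    none≥y = countᵇ-none (≤ᵇ-false z<y ∷ All.map (λ w≤z → ≤ᵇ-false (≤-<-trans w≤z z<y)) a)
  ...   | suc t | inj₂ refl rewrite ≤ᵇ-true (≤-refl {y}) with hi
  ...     | s≤s hi′ = begin
    F y 0 * ∏pos F₁ (y ∷ zs)          ≈⟨ *-congˡ (≡⇒≈ (cong (∏pos F₁) (≡.sym (insertDec-max a)))) ⟩
    F y 0 * ∏pos F₁ (insertDec y zs)  ≈⟨ *-congˡ (∏pos-insertDec s y t lo′ hi′ F₁) ⟩
    F y 0 * (F y (suc t) * ∏pos (λ w c → F w (suc (punchInℕ t c))) zs) ≈⟨ ∏pos-punchIn-suc F y y t zs ⟩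
    F y (suc t) * ∏pos (λ w c → F w (punchInℕ (suc t) c)) (y ∷ zs) ∎
    where
    F₁ = λ w c → F w (suc c)
    lo′ : countᵇ (y <ᵇ_) zs ≤ t
    lo′ rewrite countᵇ-none (All.map <ᵇ-false a) = z≤n
  ∏pos-insertDec {v = z ∷ zs} (a ∷ s) y t lo hi F | false | ofⁿ z≰y
    rewrite <ᵇ-true (≰⇒> z≰y) | ≤ᵇ-true (<⇒≤ (≰⇒> z≰y)) with t | lo | hi
  ... | zero  | () | _
  ... | suc t | s≤s lo′ | s≤s hi′ = begin
    F z 0 * ∏pos F₁ (insertDec y zs) ≈⟨ *-congˡ (∏pos-insertDec s y t lo′ hi′ F₁) ⟩
    F z 0 * (F y (suc t) * ∏pos (λ w c → F w (suc (punchInℕ t c))) zs) ≈⟨ ∏pos-punchIn-suc F z y t zs ⟩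
    F y (suc t) * ∏pos (λ w c → F w (punchInℕ (suc t) c)) (z ∷ zs) ∎
    where F₁ = λ w c → F w (suc c)

  ∏-rank-cons : ∀ {n} x x′ (γ δ : Vec ℕ n) →
    countᵇ (x′ <ᵇ_) δ ≤ countᵇ (x <ᵇ_) γ → countᵇ (x <ᵇ_) γ ≤ countᵇ (x′ ≤ᵇ_) δ → ∀ F →
    let G = λ w c → F w (punchInℕ (countᵇ (x <ᵇ_) γ) c) in
    ∏ (λ k → G (lookup δ k) (rank γ k)) ≈ ∏pos G (sortDec δ) →
    ∏ (λ i → F (lookup (x′ ∷ δ) i) (rank (x ∷ γ) i)) ≈ ∏pos F (sortDec (x′ ∷ δ))
  ∏-rank-cons x x′ γ δ lo hi F ih = begin
    F x′ (rank (x ∷ γ) fzero) * ∏ (λ k → F (lookup δ k) (rank (x ∷ γ) (fsuc k)))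
      ≈⟨ *-cong (≡⇒≈ (cong (F x′) (rank-head x γ)))
                (∏-cong {x = λ k → F (lookup δ k) (rank (x ∷ γ) (fsuc k))}
                        (λ k → ≡⇒≈ (cong (F (lookup δ k)) (rank-tail-punchIn x γ k)))) ⟩
    F x′ t * ∏ (λ k → G (lookup δ k) (rank γ k))  ≈⟨ *-congˡ ih ⟩
    F x′ t * ∏pos G (sortDec δ)                   ≈⟨ sym (∏pos-insertDec (sortDec-sorted δ) x′ t lo′ hi′ F) ⟩
    ∏pos F (insertDec x′ (sortDec δ))             ∎
    where
    t = countᵇ (x <ᵇ_) γ
    G = λ w c → F w (punchInℕ t c)
    lo′ : countᵇ (x′ <ᵇ_) (sortDec δ) ≤ t
    lo′ = ≤-trans (≤-reflexive (countᵇ-sortDec (x′ <ᵇ_) δ)) lo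
    hi′ : t ≤ countᵇ (x′ ≤ᵇ_) (sortDec δ)
    hi′ = ≤-trans hi (≤-reflexive (≡.sym (countᵇ-sortDec (x′ ≤ᵇ_) δ)))

  -- rank γ also sorts the bumped vector decreasingly: γ_i > γ_j still gives a weak inequality after
  -- bumping, and among equal entries of γ the bumped ones come first, as ties are broken by position.
  ∏-rank-sortDec : ∀ {n} m (γ : Vec ℕ n) F →
    ∏ (λ i → F (lookup (bumpPrefix m γ) i) (rank γ i)) ≈ ∏pos F (sortDec (bumpPrefix m γ))
  ∏-rank-sortDec zero    []      F = ≈-refl
  ∏-rank-sortDec (suc m) []      F = ≈-refl
  ∏-rank-sortDec zero    (x ∷ γ) F =
    ∏-rank-cons x x γ γ ≤-refl (countᵇ-mono (<ᵇ⇒≤ᵇ x) γ) F (∏-rank-sortDec zero γ G)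
    where G = λ w c → F w (punchInℕ (countᵇ (x <ᵇ_) γ) c)
  ∏-rank-sortDec (suc m) (x ∷ γ) F =
    ∏-rank-cons x (suc x) γ (bumpPrefix m γ) (countᵇ->-bumpPrefix x m γ) (countᵇ-≥-bumpPrefix x m γ) F
                (∏-rank-sortDec m γ G)
    where G = λ w c → F w (punchInℕ (countᵇ (x <ᵇ_) γ) c)

  εfactor : Carrier → Carrier → ℕ → ℕ → Carrier
  εfactor α u w c = u + α * natR R w - natR R c

  epsilon-∏pos : ∀ {N} α (lam : Vec ℕ N) u → epsilon R α lam u ≡ ∏pos (εfactor α u) lam
  epsilon-∏pos α lam u = foldr-tabulate-∏ (λ i → εfactor α u (lookup lam i) (toℕ i)) id

  shifted-gammaBar : ∀ α u b g r →
    (if b then u + α else u) + (α * natR R g - natR R r) ≈ εfactor α u (if b then suc g else g) r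
  shifted-gammaBar α u true  g r =
    solve 4 (λ u a g r → (u :+ a) :+ (a :* g :+ r) := u :+ a :* (con 1 :+ g) :+ r) ≈-refl u α _ _
  shifted-gammaBar α u false g r = sym (+-assoc u _ _)

  ∏-gammaBar : ∀ {N} α m (γ : Vec ℕ N) u →
    ∏ (λ i → (if toℕ i <ᵇ m then u + α else u) + gammaBar R α γ i) ≈ epsilon R α (GammaCirc m γ) u
  ∏-gammaBar α m γ u = begin
    ∏ (λ i → (if toℕ i <ᵇ m then u + α else u) + gammaBar R α γ i)
      ≈⟨ ∏-cong {x = λ i → (if toℕ i <ᵇ m then u + α else u) + gammaBar R α γ i} (λ i →
           trans (shifted-gammaBar α u (toℕ i <ᵇ m) (lookup γ i) (rank γ i))
                 (≡⇒≈ (cong (λ g → εfactor α u g (rank γ i)) (≡.sym (lookup-bumpPrefix m γ i))))) ⟩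
    ∏ (λ i → εfactor α u (lookup (bumpPrefix m γ) i) (rank γ i))  ≈⟨ ∏-rank-sortDec m γ (εfactor α u) ⟩
    ∏pos (εfactor α u) (sortDec (bumpPrefix m γ))  ≡⟨ cong (∏pos (εfactor α u)) (≡.sym (GammaCirc-bumpPrefix m γ)) ⟩
    ∏pos (εfactor α u) (GammaCirc m γ)             ≡⟨ ≡.sym (epsilon-∏pos α (GammaCirc m γ) u) ⟩
    epsilon R α (GammaCirc m γ) u                  ∎

  -- Pairing polynomials with weights

  pairing : ∀ {N} → Poly R N → (Vec ℕ N → Carrier) → Carrier
  pairing []            w = 0#
  pairing ((d , a) ∷ p) w = d * w a + pairing p w

  infix 4 _≈ʷ_
  _≈ʷ_ : ∀ {N} → Poly R N → Poly R N → Set (c ⊔ ℓ)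
  p ≈ʷ q = ∀ w → pairing p w ≈ pairing q w

  pairing-++ : ∀ {N} (p q : Poly R N) w → pairing (p List.++ q) w ≈ pairing p w + pairing q w
  pairing-++ []            q w = sym (+-identityˡ _)
  pairing-++ ((d , a) ∷ p) q w = trans (+-congˡ (pairing-++ p q w)) (sym (+-assoc _ _ _))

  pairing-scale : ∀ {N} k (p : Poly R N) w → pairing (scale R k p) w ≈ k * pairing p w
  pairing-scale k []            w = sym (zeroʳ k)
  pairing-scale k ((d , a) ∷ p) w = begin
    k * d * w a + pairing (scale R k p) w ≈⟨ +-cong (*-assoc k d (w a)) (pairing-scale k p w) ⟩
    k * (d * w a) + k * pairing p w      ≈⟨ sym (distribˡ k _ _) ⟩
    k * (d * w a + pairing p w)          ∎

  pairing-congʷ : ∀ {N} (p : Poly R N) {w w′} → (∀ a → w a ≈ w′ a) → pairing p w ≈ pairing p w′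
  pairing-congʷ []            w≈w′ = ≈-refl
  pairing-congʷ ((d , a) ∷ p) w≈w′ = +-cong (*-congˡ (w≈w′ a)) (pairing-congʷ p w≈w′)

  pairing-+ʷ : ∀ {N} (p : Poly R N) w w′ → pairing p (λ a → w a + w′ a) ≈ pairing p w + pairing p w′
  pairing-+ʷ []            w w′ = sym (+-identityˡ _)
  pairing-+ʷ ((d , a) ∷ p) w w′ = begin
    d * (w a + w′ a) + pairing p (λ a → w a + w′ a) ≈⟨ +-cong (distribˡ d _ _) (pairing-+ʷ p w w′) ⟩
    (d * w a + d * w′ a) + (pairing p w + pairing p w′)
      ≈⟨ solve 4 (λ x y z t → (x :+ y) :+ (z :+ t) := (x :+ z) :+ (y :+ t)) ≈-refl _ _ _ _ ⟩
    (d * w a + pairing p w) + (d * w′ a + pairing p w′) ∎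

  pairing-*ʷ : ∀ {N} (p : Poly R N) k w → pairing p (λ a → k * w a) ≈ k * pairing p w
  pairing-*ʷ []            k w = sym (zeroʳ k)
  pairing-*ʷ ((d , a) ∷ p) k w = begin
    d * (k * w a) + pairing p (λ a → k * w a) ≈⟨ +-congˡ (pairing-*ʷ p k w) ⟩
    d * (k * w a) + k * pairing p w
      ≈⟨ solve 4 (λ d k x y → d :* (k :* x) :+ k :* y := k :* (d :* x :+ y)) ≈-refl _ _ _ _ ⟩
    k * (d * w a + pairing p w) ∎

  pairing-0ʷ : ∀ {N} (p : Poly R N) → pairing p (λ _ → 0#) ≈ 0#
  pairing-0ʷ []            = ≈-refl
  pairing-0ʷ ((d , a) ∷ p) = trans (+-cong (zeroʳ d) (pairing-0ʷ p)) (+-identityˡ 0#)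

  indicator : ∀ {N} → Vec ℕ N → Vec ℕ N → Carrier
  indicator b a = if does (≡-dec ℕ._≟_ a b) then 1# else 0#

  coeff-pairing : ∀ {N} (p : Poly R N) b → coeff R p b ≈ pairing p (indicator b)
  coeff-pairing []            b = ≈-refl
  coeff-pairing ((d , a) ∷ p) b with does (≡-dec ℕ._≟_ a b)
  ... | true  = +-cong (sym (*-identityʳ d)) (coeff-pairing p b)
  ... | false = +-cong (sym (zeroʳ d)) (coeff-pairing p b)

  ≈ʷ⇒≈P : ∀ {N} {p q : Poly R N} → p ≈ʷ q → _≈P_ R p q
  ≈ʷ⇒≈P {p = p} {q} p≈q b = trans (coeff-pairing p b) (trans (p≈q (indicator b)) (sym (coeff-pairing q b)))

  without : ∀ {N} → Vec ℕ N → Poly R N → Poly R N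
  without a = filterᵇ (λ t → not (does (≡-dec ℕ._≟_ (proj₂ t) a)))

  length-without : ∀ {N} a (p : Poly R N) → length (without a p) ≤ length p
  length-without a = length-filter _

  pairing-without : ∀ {N} a (p : Poly R N) w → pairing p w ≈ coeff R p a * w a + pairing (without a p) w
  pairing-without a []            w = sym (trans (+-identityʳ _) (zeroˡ (w a)))
  pairing-without a ((d , b) ∷ p) w with ≡-dec ℕ._≟_ b a
  ... | yes refl = trans (+-congˡ (pairing-without a p w))
                         (solve 4 (λ d x c q → d :* x :+ (c :* x :+ q) := (d :+ c) :* x :+ q) ≈-refl d (w a) _ _)
  ... | no _     = trans (+-congˡ (pairing-without a p w))
                         (solve 4 (λ y c x q → y :+ (c :* x :+ q) := (con 0 :+ c) :* x :+ (y :+ q)) ≈-refl (d * w b) _ (w a) _)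

  coeff-without : ∀ {N} a (p : Poly R N) b → b ≢ a → coeff R (without a p) b ≈ coeff R p b
  coeff-without a []            b b≢a = ≈-refl
  coeff-without a ((d , e) ∷ p) b b≢a with ≡-dec ℕ._≟_ e a
  ... | no _ = +-congˡ (coeff-without a p b b≢a)
  ... | yes refl with ≡-dec ℕ._≟_ e b
  ...   | yes refl = ⊥-elim (b≢a refl)
  ...   | no _     = trans (coeff-without a p b b≢a) (sym (+-identityˡ _))

  coeff-without-self : ∀ {N} a (p : Poly R N) → coeff R (without a p) a ≈ 0#
  coeff-without-self a []            = ≈-refl
  coeff-without-self a ((d , e) ∷ p) with ≡-dec ℕ._≟_ e a
  ... | yes _ = coeff-without-self a p
  ... | no e≢a rewrite dec-false (≡-dec ℕ._≟_ e a) e≢a = trans (+-identityˡ _) (coeff-without-self a p)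

  length-without-head : ∀ {N} d a (p : Poly R N) → length (without a ((d , a) ∷ p)) < length ((d , a) ∷ p)
  length-without-head d a p rewrite dec-true (≡-dec ℕ._≟_ a a) refl = s≤s (length-without a p)

  without-cong : ∀ {N} a {p q : Poly R N} → _≈P_ R p q → _≈P_ R (without a p) (without a q)
  without-cong a {p} {q} p≈q b with ≡-dec ℕ._≟_ b a
  ... | yes refl = trans (coeff-without-self a p) (sym (coeff-without-self a q))
  ... | no b≢a   = trans (coeff-without a p b b≢a) (trans (p≈q b) (sym (coeff-without a q b b≢a)))

  -- Induction on the total length: splitting off all terms with the exponent of some head term.
  ≈P⇒≈ʷ : ∀ {N} {p q : Poly R N} → _≈P_ R p q → p ≈ʷ q
  ≈P⇒≈ʷ {N} {p} {q} = go (length p ℕ.+ length q) p q ≤-refl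
    where
    peel : ∀ a (p q : Poly R N) → _≈P_ R p q → without a p ≈ʷ without a q → p ≈ʷ q
    peel a p q p≈q ih w = begin
      pairing p w                                 ≈⟨ pairing-without a p w ⟩
      coeff R p a * w a + pairing (without a p) w ≈⟨ +-cong (*-congʳ (p≈q a)) (ih w) ⟩
      coeff R q a * w a + pairing (without a q) w ≈⟨ sym (pairing-without a q w) ⟩
      pairing q w                                 ∎

    go : ∀ n (p q : Poly R N) → length p ℕ.+ length q ≤ n → _≈P_ R p q → p ≈ʷ q
    go n       []                  []                  _ _ w = ≈-refl
    go zero    (_ ∷ _)             _                   ()
    go zero    []                  (_ ∷ _)             ()
    go (suc n) p@((d , a) ∷ _)     q                   len p≈q =
      peel a p q p≈q (go n (without a p) (without a q)
        (≤-pred (≤-trans (+-mono-<-≤ (length-without-head d a _) (length-without a q)) len))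
        (without-cong a {p} {q} p≈q))
    go (suc n) []                  q@((d , a) ∷ _)     len p≈q =
      peel a [] q p≈q (go n [] (without a q)
        (≤-pred (≤-trans (length-without-head d a _) len)) (without-cong a {[]} {q} p≈q))

  -- Cherednik operators act termwise

  record Termwise {N} (L : Poly R N → Poly R N) : Set (c ⊔ ℓ) where
    field
      image         : Vec ℕ N → Poly R N
      pairing-image : ∀ p w → pairing (L p) w ≈ pairing p (λ a → pairing (image a) w)
  open Termwise

  termwise-id : ∀ {N} → Termwise {N} id
  termwise-id = record
    { image         = mono R
    ; pairing-image = λ p w → pairing-congʷ p (λ a → sym (trans (+-identityʳ _) (*-identityˡ _)))
    }

  termwise-scale : ∀ {N} k {L : Poly R N → Poly R N} → Termwise L → Termwise (scale R k ∘ L)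
  termwise-scale k {L} T = record { image = scale R k ∘ image T ; pairing-image = law }
    where
    law : ∀ p w → pairing (scale R k (L p)) w ≈ pairing p (λ a → pairing (scale R k (image T a)) w)
    law p w = begin
      pairing (scale R k (L p)) w                      ≈⟨ pairing-scale k (L p) w ⟩
      k * pairing (L p) w                              ≈⟨ *-congˡ (pairing-image T p w) ⟩
      k * pairing p (λ a → pairing (image T a) w)      ≈⟨ sym (pairing-*ʷ p k _) ⟩
      pairing p (λ a → k * pairing (image T a) w)      ≈⟨ pairing-congʷ p (λ a → sym (pairing-scale k (image T a) w)) ⟩
      pairing p (λ a → pairing (scale R k (image T a)) w) ∎

  termwise-++ : ∀ {N} {L L′ : Poly R N → Poly R N} → Termwise L → Termwise L′ → Termwise (λ p → L p List.++ L′ p)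
  termwise-++ {L = L} {L′} T T′ = record { image = λ a → image T a List.++ image T′ a ; pairing-image = law }
    where
    law : ∀ p w → pairing (L p List.++ L′ p) w ≈ pairing p (λ a → pairing (image T a List.++ image T′ a) w)
    law p w = begin
      pairing (L p List.++ L′ p) w                  ≈⟨ pairing-++ (L p) (L′ p) w ⟩
      pairing (L p) w + pairing (L′ p) w            ≈⟨ +-cong (pairing-image T p w) (pairing-image T′ p w) ⟩
      pairing p _ + pairing p _                     ≈⟨ sym (pairing-+ʷ p _ _) ⟩
      pairing p (λ a → pairing (image T a) w + pairing (image T′ a) w)
        ≈⟨ pairing-congʷ p (λ a → sym (pairing-++ (image T a) (image T′ a) w)) ⟩
      pairing p (λ a → pairing (image T a List.++ image T′ a) w) ∎

  termwise-∘ : ∀ {N} {L L′ : Poly R N → Poly R N} → Termwise L → Termwise L′ → Termwise (L′ ∘ L)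
  termwise-∘ {L = L} {L′} T T′ = record { image = L′ ∘ image T ; pairing-image = law }
    where
    law : ∀ p w → pairing (L′ (L p)) w ≈ pairing p (λ a → pairing (L′ (image T a)) w)
    law p w = begin
      pairing (L′ (L p)) w       ≈⟨ pairing-image T′ (L p) w ⟩
      pairing (L p) _            ≈⟨ pairing-image T p _ ⟩
      pairing p _                ≈⟨ pairing-congʷ p (λ a → sym (pairing-image T′ (image T a) w)) ⟩
      pairing p (λ a → pairing (L′ (image T a)) w) ∎

  termwise-concatMap : ∀ {N} {I : Set} (is : List I) (L : I → Poly R N → Poly R N) → (∀ i → Termwise (L i)) →
                       Termwise (λ p → List.concatMap (λ i → L i p) is)
  termwise-concatMap []       L T = record { image = λ _ → [] ; pairing-image = λ p w → sym (pairing-0ʷ p) }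
  termwise-concatMap (i ∷ is) L T = termwise-++ (T i) (termwise-concatMap is L T)

  termwise-euler : ∀ {N} (j : Fin N) → Termwise (euler R j)
  termwise-euler j = record { image = λ a → (natR R (lookup a j) , a) ∷ [] ; pairing-image = law }
    where
    law : ∀ p w → pairing (euler R j p) w ≈ pairing p (λ a → pairing ((natR R (lookup a j) , a) ∷ []) w)
    law []            w = ≈-refl
    law ((d , a) ∷ p) w = +-cong (solve 3 (λ n d x → (n :* d) :* x := d :* (n :* x :+ con 0)) ≈-refl _ _ _) (law p w)

  termwise-mulX : ∀ {N} (k : Fin N) → Termwise (mulX R k)
  termwise-mulX k = record { image = λ a → mono R (a Vec.[ k ]%= suc) ; pairing-image = law }
    where
    law : ∀ p w → pairing (mulX R k p) w ≈ pairing p (λ a → pairing (mono R (a Vec.[ k ]%= suc)) w)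
    law []            w = ≈-refl
    law ((d , a) ∷ p) w = +-cong (solve 2 (λ d x → d :* x := d :* (con 1 :* x :+ con 0)) ≈-refl _ _) (law p w)

  termwise-dd : ∀ {N} (i j : Fin N) → Termwise (dd R i j)
  termwise-dd i j = record { image = ddMono R i j ; pairing-image = law }
    where
    law : ∀ p w → pairing (dd R i j p) w ≈ pairing p (λ a → pairing (ddMono R i j a) w)
    law []            w = ≈-refl
    law ((d , a) ∷ p) w = trans (pairing-++ (scale R d (ddMono R i j a)) (dd R i j p) w)
                                (+-cong (pairing-scale d (ddMono R i j a) w) (law p w))

  termwise-xi : ∀ {N} α (j : Fin N) → Termwise (xi R α j)
  termwise-xi {N} α j =
    termwise-++ (termwise-scale α (termwise-euler j))
   (termwise-++ (termwise-concatMap (filterᵇ (λ i → toℕ i <ᵇ toℕ j) (allFin N)) (λ i → mulX R j ∘ dd R i j)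
                                     (λ i → termwise-∘ (termwise-dd i j) (termwise-mulX j)))
   (termwise-++ (termwise-concatMap (filterᵇ (λ i → toℕ j <ᵇ toℕ i) (allFin N)) (λ i → mulX R i ∘ dd R i j)
                                     (λ i → termwise-∘ (termwise-dd i j) (termwise-mulX i)))
                (termwise-scale (- natR R (toℕ j)) termwise-id)))

  -- Sekiguchi operators on simultaneous eigenfunctions

  ∏ξ : ∀ {N} → Carrier → (Fin N → Carrier) → List (Fin N) → Poly R N → Poly R N
  ∏ξ α s is E = List.foldr (λ i g → scale R (s i) g List.++ xi R α i g) E is

  ∏ξ-eigen : ∀ {N} α (ev : Fin N → Carrier) {E : Poly R N} → (∀ j → _≈P_ R (xi R α j E) (scale R (ev j) E)) →
             ∀ s is → ∏ξ α s is E ≈ʷ scale R (List.foldr (λ i r → (s i + ev i) * r) 1# is) E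
  ∏ξ-eigen α ev {E} eigen s []       w = sym (trans (pairing-scale 1# E w) (*-identityˡ _))
  ∏ξ-eigen α ev {E} eigen s (i ∷ is) w = begin
    pairing (scale R (s i) g List.++ xi R α i g) w     ≈⟨ pairing-++ (scale R (s i) g) _ w ⟩
    pairing (scale R (s i) g) w + pairing (xi R α i g) w
      ≈⟨ +-cong (pairing-scale (s i) g w) (pairing-image (termwise-xi α i) g w) ⟩
    s i * pairing g w + pairing g W                    ≈⟨ +-cong (*-congˡ (ih w)) (ih W) ⟩
    s i * pairing (scale R k E) w + pairing (scale R k E) W
      ≈⟨ +-cong (*-congˡ (pairing-scale k E w)) (pairing-scale k E W) ⟩
    s i * (k * pairing E w) + k * pairing E W          ≈⟨ +-congˡ (*-congˡ (sym (pairing-image (termwise-xi α i) E w))) ⟩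
    s i * (k * pairing E w) + k * pairing (xi R α i E) w
      ≈⟨ +-congˡ (*-congˡ (trans (eigenʷ w) (pairing-scale (ev i) E w))) ⟩
    s i * (k * pairing E w) + k * (ev i * pairing E w)
      ≈⟨ solve 4 (λ s k e x → s :* (k :* x) :+ k :* (e :* x) := ((s :+ e) :* k) :* x) ≈-refl _ _ _ _ ⟩
    ((s i + ev i) * k) * pairing E w                   ≈⟨ sym (pairing-scale _ E w) ⟩
    pairing (scale R ((s i + ev i) * k) E) w           ∎
    where
    g  = ∏ξ α s is E
    k  = List.foldr (λ i r → (s i + ev i) * r) 1# is
    ih = ∏ξ-eigen α ev eigen s is
    W  = λ a → pairing (image (termwise-xi α i) a) w
    eigenʷ = ≈P⇒≈ʷ {p = xi R α i E} {q = scale R (ev i) E} (eigen i)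

  ∏ξ-allFin-eigen : ∀ {N} α (ev : Fin N → Carrier) {E : Poly R N} →
                    (∀ j → _≈P_ R (xi R α j E) (scale R (ev j) E)) →
                    ∀ s → _≈P_ R (∏ξ α s (allFin N) E) (scale R (∏ (λ i → s i + ev i)) E)
  ∏ξ-allFin-eigen {N} α ev {E} eigen s =
    ≈ʷ⇒≈P {p = ∏ξ α s (allFin N) E} {q = scale R (∏ (λ i → s i + ev i)) E} λ w →
      trans (∏ξ-eigen α ev eigen s (allFin N) w)
            (≡⇒≈ (cong (λ k → pairing (scale R k E) w) (foldr-tabulate-∏ (λ i → s i + ev i) id)))

  Scirc-≡-∏ξ : ∀ {N} α m u v (E : Poly R N) →
               Scirc R α m u v E ≡ ∏ξ α (λ i → if toℕ i <ᵇ m then u + α else v) (allFin N) E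
  Scirc-≡-∏ξ {N} α m u v E = foldr-cong step refl (allFin N)
    where
    step : ∀ i g → (if toℕ i <ᵇ m then scale R (u + α) g List.++ xi R α i g else scale R v g List.++ xi R α i g)
                   ≡ scale R (if toℕ i <ᵇ m then u + α else v) g List.++ xi R α i g
    step i g with toℕ i <ᵇ m
    ... | true  = refl
    ... | false = refl

  scale-congˡ : ∀ {N} {k k′} (E : Poly R N) → k ≈ k′ → _≈P_ R (scale R k E) (scale R k′ E)
  scale-congˡ {k = k} {k′} E k≈k′ = ≈ʷ⇒≈P {p = scale R k E} {q = scale R k′ E}
    λ w → trans (pairing-scale k E w) (trans (*-congʳ k≈k′) (sym (pairing-scale k′ E w)))

  module _ {N} α (γ : Vec ℕ N) {E : Poly R N}
           (eigen : ∀ j → _≈P_ R (xi R α j E) (scale R (gammaBar R α γ j) E)) where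

    Scirc-eigen : ∀ m u v →
      _≈P_ R (Scirc R α m u v E) (scale R (∏ (λ i → (if toℕ i <ᵇ m then u + α else v) + gammaBar R α γ i)) E)
    Scirc-eigen m u v rewrite Scirc-≡-∏ξ α m u v E = ∏ξ-allFin-eigen α (gammaBar R α γ) eigen _

    Scirc-epsilon : ∀ m u → _≈P_ R (Scirc R α m u u E) (scale R (epsilon R α (GammaCirc m γ) u) E)
    Scirc-epsilon m u b = trans (Scirc-eigen m u u b) (scale-congˡ E (∏-gammaBar α m γ u) b)

    Sstar-epsilon : ∀ u → _≈P_ R (Sstar R α u E) (scale R (epsilon R α (GammaStar γ) u) E)
    Sstar-epsilon u = ≡.subst (λ Γ → _≈P_ R (Sstar R α u E) (scale R (epsilon R α Γ u) E))
                              (GammaCirc-bumpPrefix 0 γ) (Scirc-epsilon 0 u)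

-- The field and admissibility hypotheses only make E_γ exist and be unique; the
-- eigenvalue computation holds over any commutative ring.
mainTheorem18 : ∀ {c ℓ} (R : CommutativeRing c ℓ) → IsCharZeroField R →
    let open CommutativeRing R in
    (α : Carrier) → AdmissibleParam R α →
    (N m : ℕ) → m ≤ N → (γ : Vec ℕ N) → (E : Poly R N) → IsNSJack R α γ E →
    (∀ u → _≈P_ R (Sstar R α u E) (scale R (epsilon R α (GammaStar γ) u) E))
    × (∀ u v → ∃ λ k → _≈P_ R (Scirc R α m u v E) (scale R k E))
    × (∀ u → _≈P_ R (Scirc R α m u u E) (scale R (epsilon R α (GammaCirc m γ) u) E))
mainTheorem18 R _ α _ N m _ γ E J =
    Sstar-epsilon R α γ eigen , (λ u v → _ , Scirc-eigen R α γ eigen m u v) , Scirc-epsilon R α γ eigen m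
  where open IsNSJack J using (eigen)
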